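{- Let $\mathcal T$ be a unitree containing a path of three successive edges $e_1,e_2,e_3$ with weights $s$, $t$, $s+t$, respectively. Suppose that the vertex common to $e_1$ and $e_2$ has degree $s+t$, i.e. $e_1$ and $e_2$ are its only incident edges. Then $e_3$, the edge of weight $s+t$, is a leaf.
   Context: A weighted tree is a finite bicolored plane tree with positive integer edge weights. Bicolored means that vertices are black or white and every edge joins vertices of different colors. Plane means that a cyclic order of edges around each vertex is fixed. The degree of a vertex is the sum of the weights of its incident edges. The passport is the pair of partitions of the total weight formed by the black vertex degrees and the white vertex degrees. Two weighted trees are isomorphic if there is a color-preserving bijection of vertices and edges respecting incidence, cyclic orders and weights. A unitree is a weighted tree such that every weighted tree with the same passport is isomorphic to it. A leaf is an edge one of whose endpoints has no other incident edge. Standing assumption: passports considered have $\gcd$ of all vertex degrees equal to $1$ and satisfy $p+q\le n+1$, where $n$ is the total weight and $p,q$ are the numbers of black and white vertices. -}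

module Defs where

open import Level using (0ℓ)
open import Data.Nat using (ℕ; zero; suc; _+_; _≤_)
open import Data.Nat.GCD using (gcd)
open import Data.Fin using (Fin; _≟_)
open import Data.Fin.Properties using () renaming (_≟_ to _≟F_)
open import Data.List using (List; map; filter; foldr; _++_)
open import Data.Nat.ListAction using (sum)
open import Data.List.Relation.Binary.Permutation.Propositional using (_↭_)
open import Data.Sum using (_⊎_; inj₁; inj₂)
open import Data.Product using (∃; _×_; Σ)
open import Data.List using (allFin) public
open import Function.Bundles using (_⤖_; Bijection)
open import Function.Definitions using (Injective)
open import Relation.Binary.PropositionalEquality using (_≡_)
open import Relation.Binary.Construct.Closure.ReflexiveTransitive using (Star)
open import Relation.Nullary using (¬_)

iter : {A : Set} → (A → A) → ℕ → A → A
iter f zero    x = x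
iter f (suc k) x = f (iter f k x)

Vertex : ℕ → ℕ → Set
Vertex nb nw = Fin nb ⊎ Fin nw

data Adj {nb nw m : ℕ} (blk : Fin m → Fin nb) (wht : Fin m → Fin nw)
         : Vertex nb nw → Vertex nb nw → Set where
  bw : (e : Fin m) → Adj blk wht (inj₁ (blk e)) (inj₂ (wht e))
  wb : (e : Fin m) → Adj blk wht (inj₂ (wht e)) (inj₁ (blk e))

-- Black vertices Fin nb, white vertices Fin nw, edges Fin m; edge e joins
-- black vertex blk e to white vertex wht e.  σ (resp. τ) is the rotation
-- giving the cyclic order of edges around each black (resp. white) vertex:
-- a permutation preserving the black endpoint and acting transitively
-- (as one cycle) on the edges at each black vertex.
-- Tree: connected graph with #vertices = #edges + 1.
record WTree : Set where
  field
    nb nw m : ℕ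
    blk : Fin m → Fin nb
    wht : Fin m → Fin nw
    wt  : Fin m → ℕ
    wt-pos : ∀ e → 1 ≤ wt e
    σ τ : Fin m → Fin m
    σ-inj : Injective _≡_ _≡_ σ
    τ-inj : Injective _≡_ _≡_ τ
    σ-blk : ∀ e → blk (σ e) ≡ blk e
    τ-wht : ∀ e → wht (τ e) ≡ wht e
    σ-cyc : ∀ e e′ → blk e ≡ blk e′ → ∃ λ k → iter σ k e ≡ e′
    τ-cyc : ∀ e e′ → wht e ≡ wht e′ → ∃ λ k → iter τ k e ≡ e′
    connected : ∀ u v → Star (Adj blk wht) u v
    tree-count : nb + nw ≡ suc m

  total : ℕ
  total = sum (map wt (allFin m))

  degB : Fin nb → ℕ
  degB v = sum (map wt (filter (λ e → blk e ≟F v) (allFin m)))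

  degW : Fin nw → ℕ
  degW v = sum (map wt (filter (λ e → wht e ≟F v) (allFin m)))

  blackDegrees : List ℕ
  blackDegrees = map degB (allFin nb)

  whiteDegrees : List ℕ
  whiteDegrees = map degW (allFin nw)

open WTree

SamePassport : WTree → WTree → Set
SamePassport T T′ =
  (blackDegrees T ↭ blackDegrees T′) × (whiteDegrees T ↭ whiteDegrees T′)

record Iso (T T′ : WTree) : Set where
  field
    φB : Fin (nb T) ⤖ Fin (nb T′)
    φW : Fin (nw T) ⤖ Fin (nw T′)
    φE : Fin (m T) ⤖ Fin (m T′)
  fB = Bijection.to φB
  fW = Bijection.to φW
  fE = Bijection.to φE
  field
    resp-blk : ∀ e → blk T′ (fE e) ≡ fB (blk T e)
    resp-wht : ∀ e → wht T′ (fE e) ≡ fW (wht T e)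
    resp-σ   : ∀ e → σ T′ (fE e) ≡ fE (σ T e)
    resp-τ   : ∀ e → τ T′ (fE e) ≡ fE (τ T e)
    resp-wt  : ∀ e → wt T′ (fE e) ≡ wt T e

StandingAssumption : WTree → Set
StandingAssumption T =
  (foldr gcd 0 (blackDegrees T ++ whiteDegrees T) ≡ 1) × (nb T + nw T ≤ suc (total T))

Unitree : WTree → Set
Unitree T = ∀ T′ → SamePassport T′ T → Iso T′ T

IsLeaf : (T : WTree) → Fin (m T) → Set
IsLeaf T e = (∀ e′ → blk T e′ ≡ blk T e → e′ ≡ e) ⊎ (∀ e′ → wht T e′ ≡ wht T e → e′ ≡ e)

PathWithMiddleOnly : (T : WTree) → (e₁ e₂ e₃ : Fin (m T)) → Set
PathWithMiddleOnly T e₁ e₂ e₃ =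
  ¬ (e₁ ≡ e₂) × ¬ (e₂ ≡ e₃) ×
  ( (blk T e₁ ≡ blk T e₂ × wht T e₂ ≡ wht T e₃ × degB T (blk T e₁) ≡ wt T e₁ + wt T e₂)
  ⊎ (wht T e₁ ≡ wht T e₂ × blk T e₂ ≡ blk T e₃ × degW T (wht T e₁) ≡ wt T e₁ + wt T e₂))

-- After recolouring, the vertex v shared by e₁ and e₂ is black; let x be the black end of e₃.
-- If x carried another edge, regraft: hang e₁ and e₂ at x and e₃ at v. The path v–e₂–w–e₃–x
-- becomes v–e₃–w–e₂–x, so the result is again a tree, and since wt e₃ = wt e₁ + wt e₂ every
-- vertex keeps its degree. The passport is unchanged, so the unitree property makes the two
-- trees isomorphic. But e₃ is now alone at v, so the black rotation gains a fixed point, and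
-- isomorphisms conjugate rotations.

module Submission where

open import Defs
open import Algebra.Properties.CommutativeMonoid.Sum as CommutativeMonoidSum using ()
open import Data.Empty using (⊥; ⊥-elim)
open import Data.Fin using (Fin; zero; suc; _≟_)
open import Data.Fin.Permutation.Components using (transpose; transpose-inverse)
open import Data.List using ([]; _∷_; map; filter; tabulate)
open import Data.List.Properties using (map-tabulate; map-cong)
open import Data.List.Relation.Binary.Permutation.Propositional using (↭-reflexive; ↭-refl)
open import Data.Nat using (ℕ; zero; suc; _+_; _*_; _≤_)
open import Data.Nat.ListAction using (sum)
open import Data.Nat.Properties hiding (_≟_)
open import Algebra.Properties.CommutativeSemigroup +-commutativeSemigroup
  using (xy∙z≈zy∙x; xy∙z≈xz∙y; x∙yz≈xz∙y)
open import Data.Product using (∃; _,_)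
open import Data.Sum using (_⊎_; inj₁; inj₂)
open import Data.Vec.Functional using (updateAt)
open import Data.Vec.Functional.Properties using (updateAt-updates; updateAt-minimal)
open import Function using (_∘_; id; const; Injective)
open import Function.Bundles using (_⤖_; Bijection)
open import Function.Properties.Bijection using (⤖⇒↔)
open import Relation.Binary.Construct.Closure.ReflexiveTransitive
  using (Star; ε; _◅_; _◅◅_; gmap; reverse; _⋆)
open import Relation.Binary.PropositionalEquality
open import Relation.Nullary using (¬_; Dec; yes; no)
open import Relation.Nullary.Decidable using (dec-true; dec-false)

open CommutativeMonoidSum +-0-commutativeMonoid using (sum-cong-≗; sum-permute) renaming (sum to ∑)

∑-updateAt : ∀ {n} (f : Fin n → ℕ) i (g : ℕ → ℕ) → ∑ (updateAt f i g) + f i ≡ ∑ f + g (f i)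
∑-updateAt f zero    g = xy∙z≈zy∙x (g (f zero)) (∑ (f ∘ suc)) (f zero)
∑-updateAt f (suc i) g = begin
  f zero + ∑ (updateAt (f ∘ suc) i g) + f (suc i)   ≡⟨ +-assoc (f zero) _ _ ⟩
  f zero + (∑ (updateAt (f ∘ suc) i g) + f (suc i)) ≡⟨ cong (f zero +_) (∑-updateAt (f ∘ suc) i g) ⟩
  f zero + (∑ (f ∘ suc) + g (f (suc i)))            ≡⟨ +-assoc (f zero) _ _ ⟨
  f zero + ∑ (f ∘ suc) + g (f (suc i))              ∎
  where open ≡-Reasoning

∑-exchange : ∀ {n} (f g : Fin n → ℕ) i → (∀ j → j ≢ i → f j ≡ g j) → ∑ f + g i ≡ ∑ g + f i
∑-exchange f g i agree = begin
  ∑ f + g i                             ≡⟨ ∑-updateAt f i (const (g i)) ⟨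
  ∑ (updateAt f i (const (g i))) + f i  ≡⟨ cong (_+ f i) (sum-cong-≗ updated≗g) ⟩
  ∑ g + f i                             ∎
  where
  open ≡-Reasoning
  updated≗g : ∀ j → updateAt f i (const (g i)) j ≡ g j
  updated≗g j with j ≟ i
  ... | yes refl = updateAt-updates i f
  ... | no j≢i   = trans (updateAt-minimal j i f j≢i) (agree j j≢i)

∑-removeAt : ∀ {n} (f : Fin n → ℕ) i → ∑ f ≡ ∑ (updateAt f i (const 0)) + f i
∑-removeAt f i = trans (sym (+-identityʳ (∑ f))) (sym (∑-updateAt f i (const 0)))

∑-≥-three : ∀ {n} (f : Fin n → ℕ) {a b c} → a ≢ b → a ≢ c → b ≢ c → f a + f b + f c ≤ ∑ f
∑-≥-three f {a} {b} {c} a≢b a≢c b≢c = begin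
  f a + f b + f c            ≡⟨ xy∙z≈zy∙x (f a) (f b) (f c) ⟩
  f c + f b + f a            ≤⟨ +-monoˡ-≤ (f a) (+-monoˡ-≤ (f b) fc≤∑f₂) ⟩
  ∑ f₂ + f b + f a           ≡⟨ cong (λ y → ∑ f₂ + y + f a) (updateAt-minimal b a f (a≢b ∘ sym)) ⟨
  ∑ f₂ + f₁ b + f a          ≡⟨ cong (_+ f a) (∑-removeAt f₁ b) ⟨
  ∑ f₁ + f a                 ≡⟨ ∑-removeAt f a ⟨
  ∑ f                        ∎
  where
  open ≤-Reasoning
  f₁ f₂ : Fin _ → ℕ
  f₁ = updateAt f a (const 0)
  f₂ = updateAt f₁ b (const 0)
  fc≤∑f₂ : f c ≤ ∑ f₂
  fc≤∑f₂ = begin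
    f c                                 ≡⟨ updateAt-minimal c a f (a≢c ∘ sym) ⟨
    f₁ c                                ≡⟨ updateAt-minimal c b f₁ (b≢c ∘ sym) ⟨
    f₂ c                                ≤⟨ m≤n+m (f₂ c) _ ⟩
    ∑ (updateAt f₂ c (const 0)) + f₂ c  ≡⟨ ∑-removeAt f₂ c ⟨
    ∑ f₂                                ∎

indicator : ∀ {a} {A : Set a} → Dec A → ℕ
indicator (yes _) = 1
indicator (no _)  = 0

indicator-cong : ∀ {a b} {A : Set a} {B : Set b} (A? : Dec A) (B? : Dec B) →
                 (A → B) → (B → A) → indicator A? ≡ indicator B?
indicator-cong (yes _) (yes _) _   _   = refl
indicator-cong (yes a) (no ¬b) a→b _   = ⊥-elim (¬b (a→b a))
indicator-cong (no ¬a) (yes b) _   b→a = ⊥-elim (¬a (b→a b))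
indicator-cong (no _)  (no _)  _   _   = refl

indicator-yes : ∀ {a} {A : Set a} (A? : Dec A) → A → indicator A? ≡ 1
indicator-yes (yes _) _ = refl
indicator-yes (no ¬a) a = ⊥-elim (¬a a)

indicator-no : ∀ {a} {A : Set a} (A? : Dec A) → ¬ A → indicator A? ≡ 0
indicator-no (yes a) ¬a = ⊥-elim (¬a a)
indicator-no (no _)  _  = refl

sum-map-filter : ∀ {a p} {A : Set a} {P : A → Set p} (P? : ∀ x → Dec (P x)) (w : A → ℕ) xs →
                 sum (map w (filter P? xs)) ≡ sum (map (λ x → indicator (P? x) * w x) xs)
sum-map-filter P? w []       = refl
sum-map-filter P? w (x ∷ xs) with P? x
... | yes _ = cong₂ _+_ (sym (+-identityʳ (w x))) (sum-map-filter P? w xs)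
... | no _  = sum-map-filter P? w xs

sum-map-allFin : ∀ {n} (f : Fin n → ℕ) → sum (map f (allFin n)) ≡ ∑ f
sum-map-allFin f = trans (cong sum (map-tabulate id f)) (sum-tabulate f)
  where
  sum-tabulate : ∀ {n} (f : Fin n → ℕ) → sum (tabulate f) ≡ ∑ f
  sum-tabulate {zero}  f = refl
  sum-tabulate {suc n} f = cong (f zero +_) (sum-tabulate (f ∘ suc))

degreeAt : ∀ {m k} → (Fin m → Fin k) → (Fin m → ℕ) → Fin k → ℕ
degreeAt end w u = ∑ λ e → indicator (end e ≟ u) * w e

degB≡degreeAt : ∀ T u → WTree.degB T u ≡ degreeAt (WTree.blk T) (WTree.wt T) u
degB≡degreeAt T u = trans (sum-map-filter (λ e → blk e ≟ u) wt (allFin m)) (sum-map-allFin {m} _)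
  where open WTree T

degreeAt-updateAt : ∀ {m k} (end : Fin m → Fin k) w a {u₀} u′ u → end a ≡ u₀ →
  degreeAt (updateAt end a (const u′)) w u + indicator (u₀ ≟ u) * w a
    ≡ degreeAt end w u + indicator (u′ ≟ u) * w a
degreeAt-updateAt end w a u′ u refl = begin
  degreeAt end′ w u + indicator (end a ≟ u) * w a   ≡⟨ ∑-exchange _ _ a agree ⟩
  degreeAt end w u + indicator (end′ a ≟ u) * w a   ≡⟨ cong (λ y → degreeAt end w u + indicator (y ≟ u) * w a)
                                                           (updateAt-updates a end) ⟩
  degreeAt end w u + indicator (u′ ≟ u) * w a       ∎
  where
  open ≡-Reasoning
  end′ : Fin _ → Fin _
  end′ = updateAt end a (const u′)
  agree : ∀ e → e ≢ a → indicator (end′ e ≟ u) * w e ≡ indicator (end e ≟ u) * w e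
  agree e e≢a = cong (λ y → indicator (y ≟ u) * w e) (updateAt-minimal e a end e≢a)

degreeAt-trade : ∀ {m k} (end : Fin m → Fin k) (w : Fin m → ℕ) {a a′ c} →
  a′ ≢ a → c ≢ a → c ≢ a′ → end a′ ≡ end a → w c ≡ w a + w a′ →
  let moved = updateAt (updateAt end a (const (end c))) a′ (const (end c)) in
  ∀ u → degreeAt (updateAt moved c (const (end a))) w u ≡ degreeAt end w u
degreeAt-trade end w {a} {a′} {c} a′≢a c≢a c≢a′ end-a′ w-c u =
  +-cancelʳ-≡ (X * (w a + w a′)) d₃ d₀ (begin
    d₃ + X * (w a + w a′)      ≡⟨ cong (λ p → d₃ + X * p) w-c ⟨
    d₃ + X * w c               ≡⟨ degreeAt-updateAt end₂ w c (end a) u end₂-c ⟩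
    d₂ + V * w c               ≡⟨ cong (λ p → d₂ + V * p) w-c ⟩
    d₂ + V * (w a + w a′)      ≡⟨ cong (d₂ +_) (*-distribˡ-+ V (w a) (w a′)) ⟩
    d₂ + (V * w a + V * w a′)  ≡⟨ x∙yz≈xz∙y d₂ (V * w a) (V * w a′) ⟩
    d₂ + V * w a′ + V * w a    ≡⟨ cong (_+ V * w a) (degreeAt-updateAt end₁ w a′ (end c) u end₁-a′) ⟩
    d₁ + X * w a′ + V * w a    ≡⟨ xy∙z≈xz∙y d₁ (X * w a′) (V * w a) ⟩
    d₁ + V * w a + X * w a′    ≡⟨ cong (_+ X * w a′) (degreeAt-updateAt end w a (end c) u refl) ⟩
    d₀ + X * w a + X * w a′    ≡⟨ +-assoc d₀ (X * w a) (X * w a′) ⟩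
    d₀ + (X * w a + X * w a′)  ≡⟨ cong (d₀ +_) (*-distribˡ-+ X (w a) (w a′)) ⟨
    d₀ + X * (w a + w a′)      ∎)
  where
  open ≡-Reasoning
  end₁ end₂ : Fin _ → Fin _
  end₁ = updateAt end a (const (end c))
  end₂ = updateAt end₁ a′ (const (end c))
  X V d₀ d₁ d₂ d₃ : ℕ
  X  = indicator (end c ≟ u)
  V  = indicator (end a ≟ u)
  d₀ = degreeAt end w u
  d₁ = degreeAt end₁ w u
  d₂ = degreeAt end₂ w u
  d₃ = degreeAt (updateAt end₂ c (const (end a))) w u
  end₁-a′ : end₁ a′ ≡ end a
  end₁-a′ = trans (updateAt-minimal a′ a end a′≢a) end-a′
  end₂-c : end₂ c ≡ end c
  end₂-c = trans (updateAt-minimal c a′ end₁ c≢a′) (updateAt-minimal c a end c≢a)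

fixedPoints : ∀ {n} → (Fin n → Fin n) → ℕ
fixedPoints f = ∑ λ i → indicator (f i ≟ i)

fixedPoints-conj : ∀ {m n} {f : Fin m → Fin m} {g : Fin n → Fin n} (φ : Fin m ⤖ Fin n) →
  let open Bijection φ using (to) in
  (∀ i → g (to i) ≡ to (f i)) → fixedPoints f ≡ fixedPoints g
fixedPoints-conj {f = f} {g} φ g∘φ≡φ∘f =
  trans (sum-cong-≗ λ i → indicator-cong (f i ≟ i) (g (to i) ≟ to i) (fixed⇒fixed i) (fixed⇐fixed i))
        (sym (sum-permute (λ j → indicator (g j ≟ j)) (⤖⇒↔ φ)))
  where
  open Bijection φ using (to; injective)
  fixed⇒fixed : ∀ i → f i ≡ i → g (to i) ≡ to i
  fixed⇒fixed i fi≡i = trans (g∘φ≡φ∘f i) (cong to fi≡i)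
  fixed⇐fixed : ∀ i → g (to i) ≡ to i → f i ≡ i
  fixed⇐fixed i gφi≡φi = injective (trans (sym (g∘φ≡φ∘f i)) gφi≡φi)

Reach : ∀ {A : Set} → (A → A) → A → A → Set
Reach f = Star λ x y → f x ≡ y

Reach-iter : ∀ {A : Set} (f : A → A) k x → Reach f x (iter f k x)
Reach-iter f zero    x = ε
Reach-iter f (suc k) x = Reach-iter f k x ◅◅ (refl ◅ ε)

Reach⇒iter : ∀ {A : Set} {f : A → A} {x y} → Reach f x y → ∃ λ k → iter f k x ≡ y
Reach⇒iter ε = 0 , refl
Reach⇒iter {f = f} {x} (refl ◅ r) with Reach⇒iter r
... | k , fᵏ⁺¹x≡y = suc k , trans (iter-suc k x) fᵏ⁺¹x≡y
  where
  iter-suc : ∀ k x → iter f (suc k) x ≡ iter f k (f x)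
  iter-suc zero    x = refl
  iter-suc (suc k) x = cong f (iter-suc k x)

Reach-fixed : ∀ {A : Set} {f : A → A} {x y} → f x ≡ x → Reach f x y → x ≡ y
Reach-fixed {f = f} {x} fx≡x = stuck refl
  where
  stuck : ∀ {z y} → x ≡ z → Reach f z y → x ≡ y
  stuck x≡z ε           = x≡z
  stuck x≡z (fz≡z′ ◅ r) = stuck (trans (sym fx≡x) (trans (cong f x≡z) fz≡z′)) r

Reach-transfer : ∀ {p} {A : Set} {f g : A → A} (P : A → Set p) →
  (∀ {x} → P x → P (f x)) → (∀ {x} → P x → g x ≡ f x) →
  ∀ {x y} → P x → Reach f x y → Reach g x y
Reach-transfer P P-step g≡f Px ε          = ε
Reach-transfer P P-step g≡f Px (refl ◅ r) = g≡f Px ◅ Reach-transfer P P-step g≡f (P-step Px) r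

module _ {n} (i j : Fin n) where

  transpose-matchˡ : transpose i j i ≡ j
  transpose-matchˡ rewrite dec-true (i ≟ i) refl = refl

  transpose-matchʳ : transpose i j j ≡ i
  transpose-matchʳ with j ≟ i
  ... | yes j≡i = j≡i
  ... | no _ rewrite dec-true (j ≟ j) refl = refl

  transpose-other : ∀ {k} → k ≢ i → k ≢ j → transpose i j k ≡ k
  transpose-other {k} k≢i k≢j rewrite dec-false (k ≟ i) k≢i | dec-false (k ≟ j) k≢j = refl

  transpose-injective : Injective _≡_ _≡_ (transpose i j)
  transpose-injective eq =
    trans (sym (transpose-inverse j i)) (trans (cong (transpose j i) eq) (transpose-inverse j i))

  transpose-invariant : ∀ {a} {A : Set a} (f : Fin n → A) → f i ≡ f j → ∀ k → f (transpose i j k) ≡ f k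
  transpose-invariant f fi≡fj k = by-cases (k ≟ i) (k ≟ j)
    where
    by-cases : Dec (k ≡ i) → Dec (k ≡ j) → f (transpose i j k) ≡ f k
    by-cases (yes refl) _          = trans (cong f transpose-matchˡ) (sym fi≡fj)
    by-cases (no _)     (yes refl) = trans (cong f transpose-matchʳ) fi≡fj
    by-cases (no k≢i)   (no k≢j)   = cong f (transpose-other k≢i k≢j)

Adj-sym : ∀ {p q m} {blk : Fin m → Fin p} {wht : Fin m → Fin q} {u u′} → Adj blk wht u u′ → Adj blk wht u′ u
Adj-sym (bw e) = wb e
Adj-sym (wb e) = bw e

swapColour : ∀ {p q} → Vertex p q → Vertex q p
swapColour (inj₁ b) = inj₂ b
swapColour (inj₂ w) = inj₁ w

swapColour-involutive : ∀ {p q} (u : Vertex p q) → swapColour (swapColour u) ≡ u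
swapColour-involutive (inj₁ _) = refl
swapColour-involutive (inj₂ _) = refl

Adj-swapColour : ∀ {p q m} {blk : Fin m → Fin p} {wht : Fin m → Fin q} {u u′} →
  Adj blk wht u u′ → Adj wht blk (swapColour u) (swapColour u′)
Adj-swapColour (bw e) = wb e
Adj-swapColour (wb e) = bw e

recolour : WTree → WTree
recolour T = record
  { nb = nw ; nw = nb ; m = m ; blk = wht ; wht = blk ; wt = wt ; wt-pos = wt-pos
  ; σ = τ ; τ = σ ; σ-inj = τ-inj ; τ-inj = σ-inj ; σ-blk = τ-wht ; τ-wht = σ-blk
  ; σ-cyc = τ-cyc ; τ-cyc = σ-cyc
  ; connected = λ u u′ → subst₂ (Star (Adj wht blk)) (swapColour-involutive u) (swapColour-involutive u′)
                           (gmap swapColour Adj-swapColour (connected (swapColour u) (swapColour u′)))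
  ; tree-count = trans (+-comm nw nb) tree-count
  }
  where open WTree T

Unitree-recolour : ∀ T → Unitree T → Unitree (recolour T)
Unitree-recolour T unitree T′ (black↭ , white↭) = record
  { φB = φW ; φW = φB ; φE = φE
  ; resp-blk = resp-wht ; resp-wht = resp-blk ; resp-σ = resp-τ ; resp-τ = resp-σ ; resp-wt = resp-wt }
  where open Iso (unitree (recolour T′) (white↭ , black↭))

module _ (T : WTree) where

  open WTree T

  σ-orbit : ∀ {e e′} → blk e ≡ blk e′ → Reach σ e e′
  σ-orbit {e} {e′} same-blk with σ-cyc e e′ same-blk
  ... | k , σᵏe≡e′ = subst (Reach σ e) σᵏe≡e′ (Reach-iter σ k e)

  σ-moves-shared : ∀ {e e′} → e ≢ e′ → blk e ≡ blk e′ → σ e ≢ e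
  σ-moves-shared e≢e′ same-blk σe≡e = e≢e′ (Reach-fixed σe≡e (σ-orbit same-blk))

  module BlackPath
    {e₁ e₂ e₃ : Fin m}
    (e₁≢e₂ : e₁ ≢ e₂) (e₂≢e₃ : e₂ ≢ e₃)
    (blk-e₁≡blk-e₂ : blk e₁ ≡ blk e₂) (wht-e₂≡wht-e₃ : wht e₂ ≡ wht e₃)
    (degB-v : degB (blk e₁) ≡ wt e₁ + wt e₂) (wt-e₃ : wt e₃ ≡ wt e₁ + wt e₂)
    where

    v x : Fin nb
    v = blk e₁
    x = blk e₃

    e₁≢e₃ : e₁ ≢ e₃
    e₁≢e₃ e₁≡e₃ = <-irrefl (trans (cong wt e₁≡e₃) wt-e₃) (m<m+n (wt e₁) (wt-pos e₂))

    at-v : ∀ {e} → blk e ≡ v → e ≡ e₁ ⊎ e ≡ e₂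
    at-v {e} e-at-v with e ≟ e₁ | e ≟ e₂
    ... | yes e≡e₁ | _        = inj₁ e≡e₁
    ... | no _     | yes e≡e₂ = inj₂ e≡e₂
    ... | no e≢e₁  | no e≢e₂  = ⊥-elim (<⇒≱ (m<m+n (wt e₁ + wt e₂) (wt-pos e)) three-edges-at-v)
      where
      weight-at-v : ∀ {e′} → blk e′ ≡ v → indicator (blk e′ ≟ v) * wt e′ ≡ wt e′
      weight-at-v {e′} e′-at-v =
        trans (cong (_* wt e′) (indicator-yes (blk e′ ≟ v) e′-at-v)) (*-identityˡ (wt e′))
      three-edges-at-v : wt e₁ + wt e₂ + wt e ≤ wt e₁ + wt e₂
      three-edges-at-v = subst₂ _≤_
        (cong₂ _+_ (cong₂ _+_ (weight-at-v refl) (weight-at-v (sym blk-e₁≡blk-e₂))) (weight-at-v e-at-v))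
        (trans (sym (degB≡degreeAt T v)) degB-v)
        (∑-≥-three _ e₁≢e₂ (e≢e₁ ∘ sym) (e≢e₂ ∘ sym))

    x≢v : x ≢ v
    x≢v x≡v with at-v x≡v
    ... | inj₁ e₃≡e₁ = e₁≢e₃ (sym e₃≡e₁)
    ... | inj₂ e₃≡e₂ = e₂≢e₃ (sym e₃≡e₂)

    at-x⇒off-v : ∀ {e} → blk e ≡ x → blk e ≢ v
    at-x⇒off-v e-at-x e-at-v = x≢v (trans (sym e-at-x) e-at-v)

    σe₁≡e₂ : σ e₁ ≡ e₂
    σe₁≡e₂ with at-v (σ-blk e₁)
    ... | inj₁ σe₁≡e₁ = ⊥-elim (σ-moves-shared e₁≢e₂ blk-e₁≡blk-e₂ σe₁≡e₁)
    ... | inj₂ σe₁≡e₂ = σe₁≡e₂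

    σe₂≡e₁ : σ e₂ ≡ e₁
    σe₂≡e₁ with at-v (trans (σ-blk e₂) (sym blk-e₁≡blk-e₂))
    ... | inj₁ σe₂≡e₁ = σe₂≡e₁
    ... | inj₂ σe₂≡e₂ = ⊥-elim (σ-moves-shared (e₁≢e₂ ∘ sym) (sym blk-e₁≡blk-e₂) σe₂≡e₂)

    σe₃≢e₁ : σ e₃ ≢ e₁
    σe₃≢e₁ σe₃≡e₁ = at-x⇒off-v (σ-blk e₃) (cong blk σe₃≡e₁)

    σe₃≢e₂ : σ e₃ ≢ e₂
    σe₃≢e₂ σe₃≡e₂ = at-x⇒off-v (σ-blk e₃) (trans (cong blk σe₃≡e₂) (sym blk-e₁≡blk-e₂))

    module Regraft (σe₃≢e₃ : σ e₃ ≢ e₃) where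

      -- ρ is the 3-cycle e₁ ↦ σ e₃ ↦ e₃ ↦ e₁, so σ′ splices e₁, e₂ into the rotation at x
      -- just before σ e₃ and fixes e₃.
      ρ σ′ : Fin m → Fin m
      ρ  = transpose e₁ e₃ ∘ transpose e₁ (σ e₃)
      σ′ = ρ ∘ σ

      ρ-e₁ : ρ e₁ ≡ σ e₃
      ρ-e₁ = trans (cong (transpose e₁ e₃) (transpose-matchˡ e₁ (σ e₃)))
                   (transpose-other e₁ e₃ σe₃≢e₁ σe₃≢e₃)

      ρ-σe₃ : ρ (σ e₃) ≡ e₃
      ρ-σe₃ = trans (cong (transpose e₁ e₃) (transpose-matchʳ e₁ (σ e₃))) (transpose-matchˡ e₁ e₃)

      ρ-e₃ : ρ e₃ ≡ e₁
      ρ-e₃ = trans (cong (transpose e₁ e₃) (transpose-other e₁ (σ e₃) (e₁≢e₃ ∘ sym) (σe₃≢e₃ ∘ sym)))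
                   (transpose-matchʳ e₁ e₃)

      ρ-other : ∀ {y} → y ≢ e₁ → y ≢ σ e₃ → y ≢ e₃ → ρ y ≡ y
      ρ-other y≢e₁ y≢σe₃ y≢e₃ =
        trans (cong (transpose e₁ e₃) (transpose-other e₁ (σ e₃) y≢e₁ y≢σe₃))
              (transpose-other e₁ e₃ y≢e₁ y≢e₃)

      σ′-injective : Injective _≡_ _≡_ σ′
      σ′-injective eq = σ-inj (transpose-injective e₁ (σ e₃) (transpose-injective e₁ e₃ eq))

      σ′-e₁ : σ′ e₁ ≡ e₂
      σ′-e₁ = trans (cong ρ σe₁≡e₂) (ρ-other (e₁≢e₂ ∘ sym) (σe₃≢e₂ ∘ sym) e₂≢e₃)

      σ′-e₂ : σ′ e₂ ≡ σ e₃
      σ′-e₂ = trans (cong ρ σe₂≡e₁) ρ-e₁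

      σ′-e₃ : σ′ e₃ ≡ e₃
      σ′-e₃ = ρ-σe₃

      σ′-pred-e₃ : ∀ {e} → σ e ≡ e₃ → σ′ e ≡ e₁
      σ′-pred-e₃ σe≡e₃ = trans (cong ρ σe≡e₃) ρ-e₃

      σ′-off-v : ∀ {e} → blk e ≢ v → e ≢ e₃ → σ e ≢ e₃ → σ′ e ≡ σ e
      σ′-off-v {e} e-off-v e≢e₃ σe≢e₃ =
        ρ-other (λ σe≡e₁ → e-off-v (trans (sym (σ-blk e)) (cong blk σe≡e₁))) (e≢e₃ ∘ σ-inj) σe≢e₃

      σ′-away : ∀ {e} → blk e ≢ v → blk e ≢ x → σ′ e ≡ σ e
      σ′-away {e} e-off-v e-off-x =
        σ′-off-v e-off-v (e-off-x ∘ cong blk) (λ σe≡e₃ → e-off-x (trans (sym (σ-blk e)) (cong blk σe≡e₃)))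

      merged blk′ : Fin m → Fin nb
      merged = updateAt (updateAt blk e₁ (const x)) e₂ (const x)
      blk′   = updateAt merged e₃ (const v)

      merged-at-v : ∀ {e} → blk e ≡ v → merged e ≡ x
      merged-at-v e-at-v with at-v e-at-v
      ... | inj₁ refl = trans (updateAt-minimal e₁ e₂ _ e₁≢e₂) (updateAt-updates e₁ blk)
      ... | inj₂ refl = updateAt-updates e₂ _

      merged-off-v : ∀ {e} → blk e ≢ v → merged e ≡ blk e
      merged-off-v {e} e-off-v =
        trans (updateAt-minimal e e₂ _ (λ e≡e₂ → e-off-v (trans (cong blk e≡e₂) (sym blk-e₁≡blk-e₂))))
              (updateAt-minimal e e₁ blk (e-off-v ∘ cong blk))

      merged≡x : ∀ {e} → merged e ≡ x → blk e ≡ v ⊎ blk e ≡ x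
      merged≡x {e} merged-e with blk e ≟ v
      ... | yes e-at-v = inj₁ e-at-v
      ... | no e-off-v = inj₂ (trans (sym (merged-off-v e-off-v)) merged-e)

      merged-σ : ∀ e → merged (σ e) ≡ merged e
      merged-σ e with blk e ≟ v
      ... | yes e-at-v = trans (merged-at-v (trans (σ-blk e) e-at-v)) (sym (merged-at-v e-at-v))
      ... | no e-off-v = trans (merged-off-v (e-off-v ∘ trans (sym (σ-blk e))))
                               (trans (σ-blk e) (sym (merged-off-v e-off-v)))

      merged-ρ : ∀ e → merged (ρ e) ≡ merged e
      merged-ρ e = trans (transpose-invariant e₁ e₃ merged merged-e₁≡merged-e₃ _)
                         (transpose-invariant e₁ (σ e₃) merged (trans merged-e₁≡merged-e₃ (sym (merged-σ e₃))) e)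
        where
        merged-e₁≡merged-e₃ : merged e₁ ≡ merged e₃
        merged-e₁≡merged-e₃ = trans (merged-at-v refl) (sym (merged-off-v x≢v))

      blk′-e₃ : blk′ e₃ ≡ v
      blk′-e₃ = updateAt-updates e₃ merged

      blk′-≢e₃ : ∀ {e} → e ≢ e₃ → blk′ e ≡ merged e
      blk′-≢e₃ {e} = updateAt-minimal e e₃ merged

      blk′≡v : ∀ {e} → blk′ e ≡ v → e ≡ e₃
      blk′≡v {e} blk′-e with e ≟ e₃ | blk e ≟ v
      ... | yes e≡e₃ | _          = e≡e₃
      ... | no e≢e₃  | yes e-at-v = ⊥-elim (x≢v (trans (sym (merged-at-v e-at-v)) merged-e))
        where
        merged-e : merged e ≡ v
        merged-e = trans (sym (blk′-≢e₃ e≢e₃)) blk′-e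
      ... | no e≢e₃  | no e-off-v = ⊥-elim (e-off-v (trans (sym (merged-off-v e-off-v)) merged-e))
        where
        merged-e : merged e ≡ v
        merged-e = trans (sym (blk′-≢e₃ e≢e₃)) blk′-e

      σ′-blk : ∀ e → blk′ (σ′ e) ≡ blk′ e
      σ′-blk e with e ≟ e₃
      ... | yes refl = cong blk′ σ′-e₃
      ... | no e≢e₃  = begin
        blk′ (σ′ e)     ≡⟨ blk′-≢e₃ (λ σ′e≡e₃ → e≢e₃ (σ′-injective (trans σ′e≡e₃ (sym σ′-e₃)))) ⟩
        merged (ρ (σ e)) ≡⟨ merged-ρ (σ e) ⟩
        merged (σ e)     ≡⟨ merged-σ e ⟩
        merged e         ≡⟨ blk′-≢e₃ e≢e₃ ⟨
        blk′ e           ∎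
        where open ≡-Reasoning

      reach-e₁-via-e₃ : ∀ {y} → blk y ≡ x → y ≢ e₃ → Reach σ y e₃ → Reach σ′ y e₁
      reach-e₁-via-e₃ _ y≢e₃ ε = ⊥-elim (y≢e₃ refl)
      reach-e₁-via-e₃ {y} y-at-x y≢e₃ (refl ◅ r) with σ y ≟ e₃
      ... | yes σy≡e₃ = σ′-pred-e₃ σy≡e₃ ◅ ε
      ... | no σy≢e₃  =
        σ′-off-v (at-x⇒off-v y-at-x) y≢e₃ σy≢e₃ ◅ reach-e₁-via-e₃ (trans (σ-blk y) y-at-x) σy≢e₃ r

      -- Where the σ-path passes through e₃, the σ′-path takes the detour through e₁ and e₂.
      reach-around-x : ∀ {y e} → blk y ≡ x → y ≢ e₃ → e ≢ e₃ → Reach σ y e → Reach σ′ y e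
      reach-around-x _ _ _ ε = ε
      reach-around-x {y} y-at-x y≢e₃ e≢e₃ (refl ◅ r) with σ y ≟ e₃ | r
      ... | no σy≢e₃  | _          =
        σ′-off-v (at-x⇒off-v y-at-x) y≢e₃ σy≢e₃ ◅ reach-around-x (trans (σ-blk y) y-at-x) σy≢e₃ e≢e₃ r
      ... | yes σy≡e₃ | ε          = ⊥-elim (e≢e₃ σy≡e₃)
      ... | yes σy≡e₃ | refl ◅ r′ =
        σ′-pred-e₃ σy≡e₃ ◅ σ′-e₁ ◅ trans σ′-e₂ (cong σ (sym σy≡e₃)) ◅
        reach-around-x (trans (σ-blk (σ y)) (trans (σ-blk y) y-at-x))
                 (λ σσy≡e₃ → σe₃≢e₃ (trans (cong σ (sym σy≡e₃)) σσy≡e₃)) e≢e₃ r′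

      e₁-reaches : ∀ {e} → merged e ≡ x → e ≢ e₃ → Reach σ′ e₁ e
      e₁-reaches {e} merged-e e≢e₃ with merged≡x merged-e
      ... | inj₂ e-at-x =
        σ′-e₁ ◅ σ′-e₂ ◅ reach-around-x (σ-blk e₃) σe₃≢e₃ e≢e₃ (σ-orbit (trans (σ-blk e₃) (sym e-at-x)))
      ... | inj₁ e-at-v with at-v e-at-v
      ...   | inj₁ refl = ε
      ...   | inj₂ refl = σ′-e₁ ◅ ε

      reaches-e₁ : ∀ {e} → merged e ≡ x → e ≢ e₃ → Reach σ′ e e₁
      reaches-e₁ {e} merged-e e≢e₃ with merged≡x merged-e
      ... | inj₂ e-at-x = reach-e₁-via-e₃ e-at-x e≢e₃ (σ-orbit e-at-x)
      ... | inj₁ e-at-v with at-v e-at-v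
      ...   | inj₁ refl = ε
      ...   | inj₂ refl = σ′-e₂ ◅ reach-e₁-via-e₃ (σ-blk e₃) σe₃≢e₃ (σ-orbit (σ-blk e₃))

      merged-orbit : ∀ {e e′} → e ≢ e₃ → e′ ≢ e₃ → merged e ≡ merged e′ → Reach σ′ e e′
      merged-orbit {e} {e′} e≢e₃ e′≢e₃ same with merged e ≟ x
      ... | yes merged-e = reaches-e₁ merged-e e≢e₃ ◅◅ e₁-reaches (trans (sym same) merged-e) e′≢e₃
      ... | no merged-e≢x =
        Reach-transfer (λ y → blk y ≡ blk e) (λ {y} → trans (σ-blk y)) σ′-agrees refl (σ-orbit blk-e≡blk-e′)
        where
        e-off-v : blk e ≢ v
        e-off-v = merged-e≢x ∘ merged-at-v
        blk-e≡blk-e′ : blk e ≡ blk e′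
        blk-e≡blk-e′ = trans (sym (merged-off-v e-off-v))
                             (trans same (merged-off-v (merged-e≢x ∘ trans same ∘ merged-at-v)))
        σ′-agrees : ∀ {y} → blk y ≡ blk e → σ′ y ≡ σ y
        σ′-agrees y-at-e = σ′-away (e-off-v ∘ trans (sym y-at-e))
                                   (merged-e≢x ∘ trans (merged-off-v e-off-v) ∘ trans (sym y-at-e))

      σ′-orbit : ∀ {e e′} → blk′ e ≡ blk′ e′ → Reach σ′ e e′
      σ′-orbit {e} {e′} same with e ≟ e₃ | e′ ≟ e₃
      ... | yes refl | yes refl = ε
      ... | yes refl | no e′≢e₃ = ⊥-elim (e′≢e₃ (blk′≡v (trans (sym same) blk′-e₃)))
      ... | no e≢e₃  | yes refl = ⊥-elim (e≢e₃ (blk′≡v (trans same blk′-e₃)))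
      ... | no e≢e₃  | no e′≢e₃ =
        merged-orbit e≢e₃ e′≢e₃ (trans (sym (blk′-≢e₃ e≢e₃)) (trans same (blk′-≢e₃ e′≢e₃)))

      Adj′ : Vertex nb nw → Vertex nb nw → Set
      Adj′ = Adj blk′ wht

      edge′ : ∀ e {b w} → blk′ e ≡ b → wht e ≡ w → Adj′ (inj₁ b) (inj₂ w)
      edge′ e refl refl = bw e

      blk′-e₂ : blk′ e₂ ≡ x
      blk′-e₂ = trans (blk′-≢e₃ e₂≢e₃) (merged-at-v (sym blk-e₁≡blk-e₂))

      rerouted : ∀ e → Star Adj′ (inj₁ (blk e)) (inj₂ (wht e))
      rerouted e with e ≟ e₃ | blk e ≟ v
      ... | yes refl | _          = edge′ e₂ blk′-e₂ wht-e₂≡wht-e₃ ◅ ε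
      ... | no e≢e₃  | yes e-at-v =
        edge′ e₃ (trans blk′-e₃ (sym e-at-v)) refl ◅ Adj-sym (edge′ e₂ blk′-e₂ wht-e₂≡wht-e₃) ◅
        edge′ e (trans (blk′-≢e₃ e≢e₃) (merged-at-v e-at-v)) refl ◅ ε
      ... | no e≢e₃  | no e-off-v = edge′ e (trans (blk′-≢e₃ e≢e₃) (merged-off-v e-off-v)) refl ◅ ε

      connected′ : ∀ u u′ → Star Adj′ u u′
      connected′ u u′ = (reroute ⋆) (connected u u′)
        where
        reroute : ∀ {u u′} → Adj blk wht u u′ → Star Adj′ u u′
        reroute (bw e) = rerouted e
        reroute (wb e) = reverse Adj-sym (rerouted e)

      regrafted : WTree
      regrafted = record
        { nb = nb ; nw = nw ; m = m ; blk = blk′ ; wht = wht ; wt = wt ; wt-pos = wt-pos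
        ; σ = σ′ ; τ = τ ; σ-inj = σ′-injective ; τ-inj = τ-inj ; σ-blk = σ′-blk ; τ-wht = τ-wht
        ; σ-cyc = λ e e′ same → Reach⇒iter (σ′-orbit same) ; τ-cyc = τ-cyc
        ; connected = connected′ ; tree-count = tree-count
        }

      regrafted-passport : SamePassport regrafted T
      regrafted-passport = ↭-reflexive (map-cong degB-regrafted (allFin nb)) , ↭-refl
        where
        degB-regrafted : ∀ u → WTree.degB regrafted u ≡ degB u
        degB-regrafted u = trans (degB≡degreeAt regrafted u)
          (trans (degreeAt-trade blk wt (e₁≢e₂ ∘ sym) (e₁≢e₃ ∘ sym) (e₂≢e₃ ∘ sym)
                                 (sym blk-e₁≡blk-e₂) wt-e₃ u)
                 (sym (degB≡degreeAt T u)))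

      σ-fixed⇒σ′-fixed : ∀ {e} → e ≢ e₃ → σ e ≡ e → σ′ e ≡ e
      σ-fixed⇒σ′-fixed {e} e≢e₃ σe≡e = trans (σ′-off-v e-off-v e≢e₃ (e≢e₃ ∘ trans (sym σe≡e))) σe≡e
        where
        e-off-v : blk e ≢ v
        e-off-v e-at-v with at-v e-at-v
        ... | inj₁ refl = σ-moves-shared e₁≢e₂ blk-e₁≡blk-e₂ σe≡e
        ... | inj₂ refl = σ-moves-shared (e₁≢e₂ ∘ sym) (sym blk-e₁≡blk-e₂) σe≡e

      σ′-fixed⇒σ-fixed : ∀ {e} → e ≢ e₃ → σ′ e ≡ e → σ e ≡ e
      σ′-fixed⇒σ-fixed {e} e≢e₃ σ′e≡e with blk e ≟ v | σ e ≟ e₃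
      ... | yes e-at-v | _ = ⊥-elim (moved-at-v (at-v e-at-v))
        where
        moved-at-v : e ≡ e₁ ⊎ e ≡ e₂ → ⊥
        moved-at-v (inj₁ refl) = e₁≢e₂ (trans (sym σ′e≡e) σ′-e₁)
        moved-at-v (inj₂ refl) = σe₃≢e₂ (trans (sym σ′-e₂) σ′e≡e)
      ... | no e-off-v | yes σe≡e₃ = ⊥-elim (e-off-v (cong blk (trans (sym σ′e≡e) (σ′-pred-e₃ σe≡e₃))))
      ... | no e-off-v | no σe≢e₃  = trans (sym (σ′-off-v e-off-v e≢e₃ σe≢e₃)) σ′e≡e

      fixedPoints-σ′ : fixedPoints σ′ ≡ suc (fixedPoints σ)
      fixedPoints-σ′ = begin
        fixedPoints σ′                          ≡⟨ +-identityʳ _ ⟨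
        fixedPoints σ′ + 0                      ≡⟨ cong (fixedPoints σ′ +_) (indicator-no (σ e₃ ≟ e₃) σe₃≢e₃) ⟨
        fixedPoints σ′ + indicator (σ e₃ ≟ e₃)  ≡⟨ ∑-exchange _ _ e₃ same-off-e₃ ⟩
        fixedPoints σ + indicator (σ′ e₃ ≟ e₃)  ≡⟨ cong (fixedPoints σ +_) (indicator-yes (σ′ e₃ ≟ e₃) σ′-e₃) ⟩
        fixedPoints σ + 1                       ≡⟨ +-comm (fixedPoints σ) 1 ⟩
        suc (fixedPoints σ)                     ∎
        where
        open ≡-Reasoning
        same-off-e₃ : ∀ e → e ≢ e₃ → indicator (σ′ e ≟ e) ≡ indicator (σ e ≟ e)
        same-off-e₃ e e≢e₃ =
          indicator-cong (σ′ e ≟ e) (σ e ≟ e) (σ′-fixed⇒σ-fixed e≢e₃) (σ-fixed⇒σ′-fixed e≢e₃)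

      regrafted≇T : ¬ Iso regrafted T
      regrafted≇T iso = 1+n≢n (trans (sym fixedPoints-σ′) (fixedPoints-conj φE resp-σ))
        where open Iso iso

    black-end-isolated : Unitree T → ∀ e → blk e ≡ x → e ≡ e₃
    black-end-isolated unitree e e-at-x with σ e₃ ≟ e₃
    ... | yes σe₃≡e₃ = sym (Reach-fixed σe₃≡e₃ (σ-orbit (sym e-at-x)))
    ... | no σe₃≢e₃  = ⊥-elim (regrafted≇T (unitree regrafted regrafted-passport))
      where open Regraft σe₃≢e₃

proposition5p18 : (T : WTree) → StandingAssumption T → Unitree T →
    (e₁ e₂ e₃ : Fin (WTree.m T)) (s t : ℕ) →
    WTree.wt T e₁ ≡ s → WTree.wt T e₂ ≡ t → WTree.wt T e₃ ≡ s + t →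
    PathWithMiddleOnly T e₁ e₂ e₃ →
    IsLeaf T e₃
proposition5p18 T _ unitree e₁ e₂ e₃ _ _ refl refl wt-e₃ (e₁≢e₂ , e₂≢e₃ , inj₁ (v-shared , w-shared , deg-v)) =
  inj₁ (BlackPath.black-end-isolated T e₁≢e₂ e₂≢e₃ v-shared w-shared deg-v wt-e₃ unitree)
proposition5p18 T _ unitree e₁ e₂ e₃ _ _ refl refl wt-e₃ (e₁≢e₂ , e₂≢e₃ , inj₂ (v-shared , w-shared , deg-v)) =
  inj₂ (BlackPath.black-end-isolated (recolour T) e₁≢e₂ e₂≢e₃ v-shared w-shared deg-v wt-e₃
                                     (Unitree-recolour T unitree))
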